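{- Let $\Pi$ be a set of pure axioms and $\mathrm{P}$ a set of existential saturation rules, and let $\mathfrak C$ be the class of abstract hybrid data models whose frame satisfies $\mathsf{FC}(\Pi)\wedge\mathsf{FC}(\mathrm P)$. Then every axiom of $\mathsf{HXP}+\Pi+\mathrm P$ is valid on every model of $\mathfrak C$ (true at every point), and every rule of $\mathsf{HXP}+\Pi+\mathrm P$ preserves validity over $\mathfrak C$.
   Context: Language. Fix a countable set $\mathsf{Prop}$ of propositional symbols, a countable set $\mathsf{Nom}$ of nominals with $\mathsf{Prop}\cap\mathsf{Nom}=\emptyset$, a set $\mathsf{Mod}$ of modal symbols and a set $\mathsf{Eq}$ of equality symbols. Path expressions and node expressions (formulas): $\alpha::=\mathsf a\mid @_i\mid[\varphi]\mid\alpha\beta$, $\varphi::=p\mid i\mid\neg\varphi\mid\varphi\wedge\psi\mid\langle\alpha=_e\beta\rangle\mid\langle\alpha\neq_e\beta\rangle$ ($p\in\mathsf{Prop}$, $i\in\mathsf{Nom}$, $\mathsf a\in\mathsf{Mod}$, $e\in\mathsf{Eq}$); $*$ denotes $=_e$ or $\neq_e$. Abbreviations: usual $\vee,\to,\leftrightarrow$; $\top:=p\vee\neg p$; $\bot:=\neg\top$; $\epsilon:=[\top]$; $\langle\alpha\rangle\varphi:=\langle\alpha[\varphi]=_e\alpha[\varphi]\rangle$; $[\alpha]\varphi:=\neg\langle\alpha\rangle\neg\varphi$; $@_i\varphi:=\langle @_i\rangle\varphi$. A formula is pure if it has no propositional symbols. Semantics. An abstract hybrid data model is $\mathcal M=\langle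 M,\{\sim_e\}_{e\in\mathsf{Eq}},\{R_{\mathsf a}\}_{\mathsf a\in\mathsf{Mod}},V,\mathit{nom}\rangle$ with $M\neq\emptyset$, each $\sim_e$ an equivalence relation, each $R_{\mathsf a}\subseteq M^2$, $V:M\to2^{\mathsf{Prop}}$, $\mathit{nom}:\mathsf{Nom}\to M$; its frame is $\langle M,\{\sim_e\},\{R_{\mathsf a}\}\rangle$. $\mathcal M,m,n\models\mathsf a$ iff $mR_{\mathsf a}n$; $\mathcal M,m,n\models@_i$ iff $\mathit{nom}(i)=n$; $\mathcal M,m,n\models[\varphi]$ iff $m=n$ and $\mathcal M,m\models\varphi$; $\mathcal M,m,n\models\alpha\beta$ iff for some $l$, $\mathcal M,m,l\models\alpha$ and $\mathcal M,l,n\models\beta$; $\mathcal M,m\models p$ iff $p\in V(m)$; $\mathcal M,m\models i$ iff $\mathit{nom}(i)=m$; Booleans usual; $\mathcal M,m\models\langle\alpha=_e\beta\rangle$ (resp. $\neq_e$) iff there are $n,l$ with $\mathcal M,m,n\models\alpha$, $\mathcal M,m,l\models\beta$ and $n\sim_el$ (resp. not $n\sim_el$). A rule preserves validity over $\mathfrak C$ if whenever its premises are true at every point of every model in $\mathfrak C$, so is its conclusion. The system $\mathsf{HXP}$ (schemes over node expressions $\varphi,\psi,\theta$, path expressions $\alpha,\beta,\gamma,\eta$, nominals $i,j$, $e\in\mathsf{Eq}$, $*\in\{=_e,\neq_e\}$): propositional tautologies and modus ponens; $[\alpha](\varphi\to\psi)\to([\alpha]\varphi\to[\alpha]\psi)$;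 Nec: from $\vdash\varphi$ infer $\vdash[\alpha]\varphi$; name: from $\vdash @_j\varphi$ infer $\vdash\varphi$ if $j$ does not occur in $\varphi$; paste: from $\vdash @_i\langle\mathsf a\rangle j\wedge\langle @_j\alpha*\beta\rangle\to\theta$ infer $\vdash\langle @_i\mathsf a\alpha*\beta\rangle\to\theta$ if $j\neq i$ does not occur in $\alpha,\beta,\theta$; axioms $\neg @_i\varphi\leftrightarrow @_i\neg\varphi$; $i\to(\varphi\leftrightarrow @_i\varphi)$; $@_ii$; $\langle @_j@_i\alpha*\beta\rangle\leftrightarrow\langle @_i\alpha*\beta\rangle$; $\langle\gamma @_i\alpha*\beta\rangle\to\langle @_i\alpha*\beta\rangle$; $\langle(\alpha\beta)\gamma*\eta\rangle\leftrightarrow\langle\alpha(\beta\gamma)*\eta\rangle$; $\langle\alpha\beta*\gamma\rangle\leftrightarrow\langle\alpha\epsilon\beta*\gamma\rangle$ ($\alpha$ or $\beta$ may be empty); $\langle\alpha\beta\rangle\varphi\leftrightarrow\langle\alpha\rangle\langle\beta\rangle\varphi$; $\langle\epsilon=_e\epsilon\rangle$; $\neg\langle\epsilon\neq_e\epsilon\rangle$; $\neg\langle @_i=_e@_j\rangle\leftrightarrow\langle @_i\neq_e@_j\rangle$; $\langle\epsilon=_e\alpha\rangle\wedge\langle\epsilon=_e\beta\rangle\to\langle\alpha=_e\beta\rangle$; $\langle\alpha*\beta\rangle\leftrightarrow\langle\beta*\alpha\rangle$; $\langle[\varphi]\alpha*\beta\rangle\leftrightarrow\varphi\wedge\langle\alpha*\beta\rangle$;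 $\langle @_i\alpha*@_i\beta\rangle\to @_i\langle\alpha*\beta\rangle$; $\langle\alpha\beta*\gamma\rangle\to\langle\alpha\rangle\top$; $\langle\alpha\rangle\langle\beta*\gamma\rangle\to\langle\alpha\beta*\alpha\gamma\rangle$. Extensions. Standard translation of pure formulas into first-order logic over binary symbols $R_{\mathsf a}$, $D_e$ with a variable $x_i$ per nominal: $\mathrm{ST}_x(i)=(x=x_i)$; commutes with $\neg,\wedge$; $\mathrm{ST}_x(\langle\alpha=_e\beta\rangle)=\exists y\exists z(\mathrm{ST}_{x,y}(\alpha)\wedge\mathrm{ST}_{x,z}(\beta)\wedge D_e(y,z))$ and with $\neg D_e(y,z)$ for $\neq_e$; $\mathrm{ST}_{x,y}(\mathsf a)=R_{\mathsf a}(x,y)$; $\mathrm{ST}_{x,y}(@_i)=(y=x_i)$; $\mathrm{ST}_{x,y}([\varphi])=(x=y\wedge\mathrm{ST}_y(\varphi))$; $\mathrm{ST}_{x,y}(\alpha\beta)=\exists z(\mathrm{ST}_{x,z}(\alpha)\wedge\mathrm{ST}_{z,y}(\beta))$; a frame interprets $R_{\mathsf a}$ as $R_{\mathsf a}$ and $D_e$ as $\sim_e$. For a set $\Pi$ of pure formulas, $\mathsf{FC}(\Pi)=\bigwedge_{\varphi\in\Pi}\forall x\forall x_{i_1}\dots\forall x_{i_n}\mathrm{ST}_x(\varphi)$ ($i_1..i_n$ the nominals of $\varphi$). An existential saturation rule has a pure head $\varphi$ with nominals split into $i_1..i_n$ and $j_1..j_m$: from $\vdash\varphi\to\psi$ infer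 $\vdash\psi$, provided $j_1..j_m$ do not occur in $\psi$; $\mathsf{FC}(\mathrm P)=\bigwedge\forall x\forall x_{i_1}..\forall x_{i_n}\exists x_{j_1}..\exists x_{j_m}\mathrm{ST}_x(\varphi)$ over heads of rules in $\mathrm P$. $\mathsf{HXP}+\Pi+\mathrm P$ adds $\Pi$ as axioms and $\mathrm P$ as rules. -}

module Defs where

open import Level using (0ℓ)
open import Data.Nat using (ℕ; zero; suc; _+_)
open import Data.Nat.Properties using () renaming (_≟_ to _≟ℕ_)
open import Data.Bool using (Bool; true; false; not; _∧_)
open import Data.Sum using (_⊎_; inj₁; inj₂)
open import Data.Sum.Properties using (≡-dec)
open import Data.Product using (Σ; _×_; _,_; ∃)
open import Data.List using (List; []; _∷_; _++_; foldr; filter)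
open import Data.List.Membership.Propositional using (_∈_; _∉_)
open import Data.List.Membership.DecPropositional _≟ℕ_ using (_∈?_)
open import Data.List.Relation.Unary.All using (All)
open import Data.Empty using (⊥)
open import Data.Unit using (⊤)
open import Relation.Nullary using (¬_; yes; no; ¬?)

open import Relation.Binary.PropositionalEquality using (_≡_; _≢_)
open import Relation.Binary.Structures using (IsEquivalence)

-- Symbols.  Prop = ℕ and Nom = ℕ (two separate countable sets, kept
-- apart by the syntax: propositional symbols are `prop p`, nominals
-- are `nom i`).  Mod and Eq are arbitrary sets (parameters).

PropSym : Set
PropSym = ℕ

NomSym : Set
NomSym = ℕ

mutual
  data Path (Mod Eq : Set) : Set where
    mod  : Mod → Path Mod Eq
    at   : NomSym → Path Mod Eq
    test : Form Mod Eq → Path Mod Eq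
    comp : Path Mod Eq → Path Mod Eq → Path Mod Eq

  data Form (Mod Eq : Set) : Set where
    prop : PropSym → Form Mod Eq
    nom  : NomSym → Form Mod Eq
    neg  : Form Mod Eq → Form Mod Eq
    and  : Form Mod Eq → Form Mod Eq → Form Mod Eq
    eqP  : Eq → Path Mod Eq → Path Mod Eq → Form Mod Eq
    neqP : Eq → Path Mod Eq → Path Mod Eq → Form Mod Eq

-- `*` ranges over =_e and ≠_e
data Star (Eq : Set) : Set where
  is  : Eq → Star Eq
  isn : Eq → Star Eq

cmp : ∀ {Mod Eq} → Star Eq → Path Mod Eq → Path Mod Eq → Form Mod Eq
cmp (is e)  α β = eqP e α β
cmp (isn e) α β = neqP e α β

module _ {Mod Eq : Set} where
  infixr 4 _∨'_
  infixr 3 _⇒_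
  infixr 3 _⇔_

  _∨'_ : Form Mod Eq → Form Mod Eq → Form Mod Eq
  φ ∨' ψ = neg (and (neg φ) (neg ψ))

  _⇒_ : Form Mod Eq → Form Mod Eq → Form Mod Eq
  φ ⇒ ψ = neg (and φ (neg ψ))

  _⇔_ : Form Mod Eq → Form Mod Eq → Form Mod Eq
  φ ⇔ ψ = and (φ ⇒ ψ) (ψ ⇒ φ)

  Top : Form Mod Eq
  Top = prop 0 ∨' neg (prop 0)

  Bot : Form Mod Eq
  Bot = neg Top

  eps : Path Mod Eq
  eps = test Top

  dia : Eq → Path Mod Eq → Form Mod Eq → Form Mod Eq
  dia e₀ α φ = eqP e₀ (comp α (test φ)) (comp α (test φ))

  box : Eq → Path Mod Eq → Form Mod Eq → Form Mod Eq
  box e₀ α φ = neg (dia e₀ α (neg φ))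

  atF : Eq → NomSym → Form Mod Eq → Form Mod Eq
  atF e₀ i φ = dia e₀ (at i) φ

mutual
  nomsP : ∀ {Mod Eq} → Path Mod Eq → List NomSym
  nomsP (mod a)    = []
  nomsP (at i)     = i ∷ []
  nomsP (test φ)   = nomsF φ
  nomsP (comp α β) = nomsP α ++ nomsP β

  nomsF : ∀ {Mod Eq} → Form Mod Eq → List NomSym
  nomsF (prop p)     = []
  nomsF (nom i)      = i ∷ []
  nomsF (neg φ)      = nomsF φ
  nomsF (and φ ψ)    = nomsF φ ++ nomsF ψ
  nomsF (eqP e α β)  = nomsP α ++ nomsP β
  nomsF (neqP e α β) = nomsP α ++ nomsP β

mutual
  PureP : ∀ {Mod Eq} → Path Mod Eq → Set
  PureP (mod a)    = ⊤
  PureP (at i)     = ⊤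
  PureP (test φ)   = Pure φ
  PureP (comp α β) = PureP α × PureP β

  Pure : ∀ {Mod Eq} → Form Mod Eq → Set
  Pure (prop p)     = ⊥
  Pure (nom i)      = ⊤
  Pure (neg φ)      = Pure φ
  Pure (and φ ψ)    = Pure φ × Pure ψ
  Pure (eqP e α β)  = PureP α × PureP β
  Pure (neqP e α β) = PureP α × PureP β

record Frame (Mod Eq : Set) : Set₁ where
  field
    W     : Set
    point : W                                   -- M ≠ ∅
    Sim   : Eq → W → W → Set
    isEquivalence : ∀ e → IsEquivalence (Sim e)
    R     : Mod → W → W → Set

record Model (Mod Eq : Set) : Set₁ where
  field
    frame : Frame Mod Eq
  open Frame frame public
  field
    V     : W → PropSym → Set
    nomI  : NomSym → W

open Model public

mutual
  _,_,_⊨P_ : ∀ {Mod Eq} (M : Model Mod Eq) → W M → W M → Path Mod Eq → Set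
  M , m , n ⊨P mod a    = R M a m n
  M , m , n ⊨P at i     = nomI M i ≡ n
  M , m , n ⊨P test φ   = (m ≡ n) × (M , m ⊨ φ)
  M , m , n ⊨P comp α β = Σ (W M) λ l → (M , m , l ⊨P α) × (M , l , n ⊨P β)

  _,_⊨_ : ∀ {Mod Eq} (M : Model Mod Eq) → W M → Form Mod Eq → Set
  M , m ⊨ prop p     = V M m p
  M , m ⊨ nom i      = nomI M i ≡ m
  M , m ⊨ neg φ      = ¬ (M , m ⊨ φ)
  M , m ⊨ and φ ψ    = (M , m ⊨ φ) × (M , m ⊨ ψ)
  M , m ⊨ eqP e α β  = Σ (W M) λ n → Σ (W M) λ l →
                         (M , m , n ⊨P α) × (M , m , l ⊨P β) × Sim M e n l
  M , m ⊨ neqP e α β = Σ (W M) λ n → Σ (W M) λ l →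
                         (M , m , n ⊨P α) × (M , m , l ⊨P β) × ¬ (Sim M e n l)

-- First-order language over R_a, D_e; variables are either
-- auxiliary variables (inj₁ k) or the variable x_i of nominal i (inj₂ i).

Var : Set
Var = ℕ ⊎ NomSym

_≟V_ : (u v : Var) → Relation.Nullary.Dec (u ≡ v)
_≟V_ = ≡-dec _≟ℕ_ _≟ℕ_

data FO (Mod Eq : Set) : Set where
  eqv  : Var → Var → FO Mod Eq
  Rel  : Mod → Var → Var → FO Mod Eq
  D    : Eq → Var → Var → FO Mod Eq
  fneg : FO Mod Eq → FO Mod Eq
  fand : FO Mod Eq → FO Mod Eq → FO Mod Eq
  fex  : Var → FO Mod Eq → FO Mod Eq
  fall : Var → FO Mod Eq → FO Mod Eq

module _ {Mod Eq : Set} (F : Frame Mod Eq) where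
  private
    U : Set
    U = Frame.W F

  update : (Var → U) → Var → U → (Var → U)
  update g v d u with u ≟V v
  ... | yes _ = d
  ... | no  _ = g u

  ⟦_⟧FO : FO Mod Eq → (Var → U) → Set
  ⟦ eqv u v ⟧FO g   = g u ≡ g v
  ⟦ Rel a u v ⟧FO g = Frame.R F a (g u) (g v)
  ⟦ D e u v ⟧FO g   = Frame.Sim F e (g u) (g v)
  ⟦ fneg χ ⟧FO g    = ¬ ⟦ χ ⟧FO g
  ⟦ fand χ ξ ⟧FO g  = ⟦ χ ⟧FO g × ⟦ ξ ⟧FO g
  ⟦ fex v χ ⟧FO g   = Σ U λ d → ⟦ χ ⟧FO (update g v d)
  ⟦ fall v χ ⟧FO g  = (d : U) → ⟦ χ ⟧FO (update g v d)

  FrameSat : FO Mod Eq → Set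
  FrameSat χ = (g : Var → U) → ⟦ χ ⟧FO g

-- The natural-number argument k is a counter for
-- fresh auxiliary variables (all auxiliary variables in scope are < k).
-- Propositional symbols are mapped to falsum; ST is only ever applied to
-- pure formulas.

mutual
  STP : ∀ {Mod Eq} → Var → Var → ℕ → Path Mod Eq → FO Mod Eq
  STP x y k (mod a)    = Rel a x y
  STP x y k (at i)     = eqv y (inj₂ i)
  STP x y k (test φ)   = fand (eqv x y) (STF y k φ)
  STP x y k (comp α β) =
    fex (inj₁ k) (fand (STP x (inj₁ k) (suc k) α) (STP (inj₁ k) y (suc k) β))

  STF : ∀ {Mod Eq} → Var → ℕ → Form Mod Eq → FO Mod Eq
  STF x k (prop p)     = fneg (eqv x x)
  STF x k (nom i)      = eqv x (inj₂ i)
  STF x k (neg φ)      = fneg (STF x k φ)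
  STF x k (and φ ψ)    = fand (STF x k φ) (STF x k ψ)
  STF x k (eqP e α β)  =
    fex (inj₁ k) (fex (inj₁ (suc k))
      (fand (fand (STP x (inj₁ k) (2 + k) α) (STP x (inj₁ (suc k)) (2 + k) β))
            (D e (inj₁ k) (inj₁ (suc k)))))
  STF x k (neqP e α β) =
    fex (inj₁ k) (fex (inj₁ (suc k))
      (fand (fand (STP x (inj₁ k) (2 + k) α) (STP x (inj₁ (suc k)) (2 + k) β))
            (fneg (D e (inj₁ k) (inj₁ (suc k))))))

xVar : Var
xVar = inj₁ 0

ST : ∀ {Mod Eq} → Form Mod Eq → FO Mod Eq
ST φ = STF xVar 1 φ

allNoms : ∀ {Mod Eq} → List NomSym → FO Mod Eq → FO Mod Eq
allNoms ns χ = foldr (λ i ξ → fall (inj₂ i) ξ) χ ns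

exNoms : ∀ {Mod Eq} → List NomSym → FO Mod Eq → FO Mod Eq
exNoms js χ = foldr (λ j ξ → fex (inj₂ j) ξ) χ js

FCax : ∀ {Mod Eq} → Form Mod Eq → FO Mod Eq
FCax φ = fall xVar (allNoms (nomsF φ) (ST φ))

-- existential saturation rules: pure head, with the nominals j1..jm
-- (listed in `exN`) to be existentially quantified; the others are i1..in
record ESR (Mod Eq : Set) : Set where
  constructor esr
  field
    headF : Form Mod Eq
    exN   : List NomSym
open ESR public

univN : ∀ {Mod Eq} → ESR Mod Eq → List NomSym
univN r = filter (λ i → ¬? (i ∈? exN r)) (nomsF (headF r))

FCrule : ∀ {Mod Eq} → ESR Mod Eq → FO Mod Eq
FCrule r = fall xVar (allNoms (univN r) (exNoms (exN r) (ST (headF r))))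

InC : ∀ {Mod Eq} → (Form Mod Eq → Set) → (ESR Mod Eq → Set) → Model Mod Eq → Set
InC Π P M = ((φ : _) → Π φ → FrameSat (frame M) (FCax φ))
          × ((r : _) → P r → FrameSat (frame M) (FCrule r))

ValidC : ∀ {Mod Eq} → (Form Mod Eq → Set) → (ESR Mod Eq → Set) → Form Mod Eq → Set₁
ValidC Π P φ = (M : Model _ _) → InC Π P M → (m : W M) → M , m ⊨ φ

data PF : Set where
  pv   : ℕ → PF
  pneg : PF → PF
  pand : PF → PF → PF

evalPF : (ℕ → Bool) → PF → Bool
evalPF v (pv n)     = v n
evalPF v (pneg τ)   = not (evalPF v τ)
evalPF v (pand τ σ) = evalPF v τ ∧ evalPF v σ

Tautology : PF → Set
Tautology τ = (v : ℕ → Bool) → evalPF v τ ≡ true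

instPF : ∀ {Mod Eq} → (ℕ → Form Mod Eq) → PF → Form Mod Eq
instPF σ (pv n)     = σ n
instPF σ (pneg τ)   = neg (instPF σ τ)
instPF σ (pand τ υ) = and (instPF σ τ) (instPF σ υ)

-- Axioms of HXP + Π  (juxtaposition αβγ is read as α(βγ))

data Ax {Mod Eq : Set} (e₀ : Eq) (Π : Form Mod Eq → Set) : Form Mod Eq → Set where
  taut : ∀ τ σ → Tautology τ → Ax e₀ Π (instPF σ τ)
  K    : ∀ α φ ψ → Ax e₀ Π (box e₀ α (φ ⇒ ψ) ⇒ (box e₀ α φ ⇒ box e₀ α ψ))
  at-neg : ∀ i φ → Ax e₀ Π (neg (atF e₀ i φ) ⇔ atF e₀ i (neg φ))
  at-intro : ∀ i φ → Ax e₀ Π (nom i ⇒ (φ ⇔ atF e₀ i φ))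
  at-self : ∀ i → Ax e₀ Π (atF e₀ i (nom i))
  at-at : ∀ (s : Star Eq) i j α β →
    Ax e₀ Π (cmp s (comp (at j) (comp (at i) α)) β ⇔ cmp s (comp (at i) α) β)
  pre-at : ∀ (s : Star Eq) γ i α β →
    Ax e₀ Π (cmp s (comp γ (comp (at i) α)) β ⇒ cmp s (comp (at i) α) β)
  assoc : ∀ (s : Star Eq) α β γ η →
    Ax e₀ Π (cmp s (comp (comp α β) γ) η ⇔ cmp s (comp α (comp β γ)) η)
  eps-mid : ∀ (s : Star Eq) α β γ →
    Ax e₀ Π (cmp s (comp α β) γ ⇔ cmp s (comp α (comp eps β)) γ)
  eps-left : ∀ (s : Star Eq) β γ →        -- α empty
    Ax e₀ Π (cmp s β γ ⇔ cmp s (comp eps β) γ)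
  eps-right : ∀ (s : Star Eq) α γ →       -- β empty
    Ax e₀ Π (cmp s α γ ⇔ cmp s (comp α eps) γ)
  dia-comp : ∀ α β φ →
    Ax e₀ Π (dia e₀ (comp α β) φ ⇔ dia e₀ α (dia e₀ β φ))
  eps-eq : ∀ e → Ax e₀ Π (eqP e eps eps)
  eps-neq : ∀ e → Ax e₀ Π (neg (neqP e eps eps))
  nom-neq : ∀ e i j → Ax e₀ Π (neg (eqP e (at i) (at j)) ⇔ neqP e (at i) (at j))
  eq-trans : ∀ e α β →
    Ax e₀ Π (and (eqP e eps α) (eqP e eps β) ⇒ eqP e α β)
  sym : ∀ (s : Star Eq) α β → Ax e₀ Π (cmp s α β ⇔ cmp s β α)
  test-head : ∀ (s : Star Eq) φ α β →
    Ax e₀ Π (cmp s (comp (test φ) α) β ⇔ and φ (cmp s α β))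
  at-both : ∀ (s : Star Eq) i α β →
    Ax e₀ Π (cmp s (comp (at i) α) (comp (at i) β) ⇒ atF e₀ i (cmp s α β))
  prefix : ∀ (s : Star Eq) α β γ →
    Ax e₀ Π (cmp s (comp α β) γ ⇒ dia e₀ α Top)
  dia-cmp : ∀ (s : Star Eq) α β γ →
    Ax e₀ Π (dia e₀ α (cmp s β γ) ⇒ cmp s (comp α β) (comp α γ))
  pi : ∀ φ → Π φ → Ax e₀ Π φ

data Rule {Mod Eq : Set} (e₀ : Eq) (Π : Form Mod Eq → Set) (P : ESR Mod Eq → Set)
     : List (Form Mod Eq) → Form Mod Eq → Set where
  mp   : ∀ φ ψ → Rule e₀ Π P (φ ∷ (φ ⇒ ψ) ∷ []) ψ
  nec  : ∀ α φ → Rule e₀ Π P (φ ∷ []) (box e₀ α φ)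
  name : ∀ j φ → j ∉ nomsF φ → Rule e₀ Π P (atF e₀ j φ ∷ []) φ
  paste : ∀ (s : Star Eq) i j a α β θ → j ≢ i →
    j ∉ nomsP α → j ∉ nomsP β → j ∉ nomsF θ →
    Rule e₀ Π P
      ((and (atF e₀ i (dia e₀ (mod a) (nom j))) (cmp s (comp (at j) α) β) ⇒ θ) ∷ [])
      (cmp s (comp (at i) (comp (mod a) α)) β ⇒ θ)
  sat  : ∀ r ψ → P r → All (λ j → j ∉ nomsF ψ) (exN r) →
    Rule e₀ Π P ((headF r ⇒ ψ) ∷ []) ψ

-- The HXP axioms hold in every model by
-- unfolding the satisfaction clauses (classically, for tautologies and modus ponens). An axiom
-- of Π holds because, by correctness of the standard translation on pure formulas, its frame
-- condition says that it is true at every point under every assignment of its nominals. The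
-- rules name, paste and the existential saturation rules preserve validity because membership
-- in 𝔆 depends on the frame alone: the premise may be used in the model whose fresh nominals
-- are reassigned (to the current point, to the a-successor, or to the witnesses that FC(P)
-- provides), and the conclusion, which does not mention them, is unaffected.
module Submission where

open import Defs
open import Level using (0ℓ)
open import Axiom.ExcludedMiddle using (ExcludedMiddle)
open import Data.Bool using (Bool)
open import Data.Product using (Σ; _×_; _,_)
open import Data.Nat using (ℕ; suc; _+_; _<_)
open import Data.Nat.Properties using (n<1+n; m<n⇒m<1+n; <-irrefl) renaming (_≟_ to _≟ℕ_)
open import Data.Sum using (inj₁; inj₂)
open import Data.Unit using (⊤)
open import Data.List using (List; []; _∷_)
open import Data.List.Membership.Propositional using (_∉_)
open import Data.List.Relation.Unary.Any using (here; there)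
open import Data.List.Relation.Unary.All using (All)
import Data.List.Relation.Unary.All as All
open import Data.List.Relation.Unary.All.Properties using (++⁻ˡ; ++⁻ʳ)
open import Data.Empty using (⊥-elim)
open import Relation.Nullary using (¬_; yes; no; Reflects; invert; does; proof)
open import Relation.Nullary.Reflects using (¬-reflects; _×-reflects_)
open import Relation.Nullary.Decidable using (decidable-stable)
open import Relation.Binary.PropositionalEquality
  using (_≡_; _≢_; refl; trans; subst; subst₂) renaming (sym to ≡-sym)
open import Relation.Binary.Structures using (IsEquivalence)
open import Function.Bundles using (Equivalence; mk⇔) renaming (_⇔_ to _⟺_)
import Function.Properties.Equivalence as ⟺
open Equivalence using (to; from)

⇒-intro : {A B : Set} → (A → B) → ¬ (A × ¬ B)
⇒-intro f (a , ¬b) = ¬b (f a)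

⇔-intro : {A B : Set} → (A → B) → (B → A) → ¬ (A × ¬ B) × ¬ (B × ¬ A)
⇔-intro f g = ⇒-intro f , ⇒-intro g

⇒-elim : ExcludedMiddle 0ℓ → {A B : Set} → ¬ (A × ¬ B) → A → B
⇒-elim em h a = decidable-stable em λ ¬b → h (a , ¬b)

subst₂-⟺ : ∀ {A B : Set} (S : A → B → Set) {a a′ b b′} →
  a ≡ a′ → b ≡ b′ → S a b ⟺ S a′ b′
subst₂-⟺ S refl refl = ⟺.refl

Sim⋆ : ∀ {Mod Eq} (F : Frame Mod Eq) → Star Eq → Frame.W F → Frame.W F → Set
Sim⋆ F (is e)  n l = Frame.Sim F e n l
Sim⋆ F (isn e) n l = ¬ Frame.Sim F e n l

⊨-subst : ∀ {Mod Eq} (M : Model Mod Eq) φ {m m′} → m ≡ m′ → M , m ⊨ φ → M , m′ ⊨ φ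
⊨-subst M φ = subst (λ k → M , k ⊨ φ)

module Satisfaction {Mod Eq : Set} (e₀ : Eq) (M : Model Mod Eq) where
  module ∼ (e : Eq) = IsEquivalence (isEquivalence M e)

  ⊨Top : ∀ {m} → M , m ⊨ Top
  ⊨Top (p , ¬p) = ¬p p

  Sim⋆-sym : ∀ s {n l} → Sim⋆ (frame M) s n l → Sim⋆ (frame M) s l n
  Sim⋆-sym (is e)  n∼l     = ∼.sym e n∼l
  Sim⋆-sym (isn e) n≁l l∼n = n≁l (∼.sym e l∼n)

  Compared : Star Eq → W M → Path Mod Eq → Path Mod Eq → Set
  Compared s m α β = Σ (W M) λ n → Σ (W M) λ l →
    (M , m , n ⊨P α) × (M , m , l ⊨P β) × Sim⋆ (frame M) s n l

  cmp-elim : ∀ s {m} α β → M , m ⊨ cmp s α β → Compared s m α β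
  cmp-elim (is e)  α β c = c
  cmp-elim (isn e) α β c = c

  cmp-intro : ∀ s {m} α β → Compared s m α β → M , m ⊨ cmp s α β
  cmp-intro (is e)  α β c = c
  cmp-intro (isn e) α β c = c

  cmp-mapˡ : ∀ s {m} α α′ β →
    (∀ {n} → M , m , n ⊨P α → M , m , n ⊨P α′) →
    M , m ⊨ cmp s α β → M , m ⊨ cmp s α′ β
  cmp-mapˡ s α α′ β f c with cmp-elim s α β c
  ... | n , l , a , b , x = cmp-intro s α′ β (n , l , f a , b , x)

  dia-intro : ∀ {m k} α φ → M , m , k ⊨P α → M , k ⊨ φ → M , m ⊨ dia e₀ α φ
  dia-intro {k = k} α φ a f = k , k , (k , a , refl , f) , (k , a , refl , f) , ∼.refl e₀

  dia-elim : ∀ {m} α φ → M , m ⊨ dia e₀ α φ →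
    Σ (W M) λ k → (M , m , k ⊨P α) × (M , k ⊨ φ)
  dia-elim α φ (_ , _ , (k , a , refl , f) , _) = k , a , f

  atF-elim : ∀ {m} i φ → M , m ⊨ atF e₀ i φ → M , nomI M i ⊨ φ
  atF-elim {m} i φ d with dia-elim {m} (at i) φ d
  ... | _ , i≡k , f = ⊨-subst M φ (≡-sym i≡k) f

  box-intro : ∀ {m} α φ → (∀ {k} → M , m , k ⊨P α → ¬ ¬ (M , k ⊨ φ)) →
    M , m ⊨ box e₀ α φ
  box-intro α φ h d with dia-elim α (neg φ) d
  ... | k , a , ¬f = h a ¬f

  box-elim : ∀ {m k} α φ → M , m ⊨ box e₀ α φ → M , m , k ⊨P α → ¬ ¬ (M , k ⊨ φ)
  box-elim α φ b a ¬f = b (dia-intro α (neg φ) a ¬f)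

  module _ (em : ExcludedMiddle 0ℓ) (m : W M) (σ : ℕ → Form Mod Eq) where
    -- Excluded middle decides each substituted formula; this valuation then reflects
    -- satisfaction of every instance.
    classicalValuation : ℕ → Bool
    classicalValuation n = does (em {M , m ⊨ σ n})

    instPF-reflects : ∀ τ → Reflects (M , m ⊨ instPF σ τ) (evalPF classicalValuation τ)
    instPF-reflects (pv n)     = proof em
    instPF-reflects (pneg τ)   = ¬-reflects (instPF-reflects τ)
    instPF-reflects (pand τ υ) = instPF-reflects τ ×-reflects instPF-reflects υ

    ⊨-taut : ∀ τ → Tautology τ → M , m ⊨ instPF σ τ
    ⊨-taut τ t = invert (subst (Reflects _) (t classicalValuation) (instPF-reflects τ))

module Axioms {Mod Eq : Set} (e₀ : Eq) (M : Model Mod Eq) (m : W M) where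
  open Satisfaction e₀ M

  ⊨-K : ∀ α φ ψ → M , m ⊨ (box e₀ α (φ ⇒ ψ) ⇒ (box e₀ α φ ⇒ box e₀ α ψ))
  ⊨-K α φ ψ = ⇒-intro λ □φ⇒ψ → ⇒-intro λ □φ → box-intro α ψ λ a ¬ψ →
    box-elim α φ □φ a λ φk → box-elim α (φ ⇒ ψ) □φ⇒ψ a λ φ⇒ψ → φ⇒ψ (φk , ¬ψ)

  ⊨-at-neg : ∀ i φ → M , m ⊨ (neg (atF e₀ i φ) ⇔ atF e₀ i (neg φ))
  ⊨-at-neg i φ = ⇔-intro
    (λ ¬atφ → dia-intro {m} (at i) (neg φ) refl λ f → ¬atφ (dia-intro {m} (at i) φ refl f))
    (λ at¬φ atφ → let (_ , i≡k , ¬f) = dia-elim {m} (at i) (neg φ) at¬φ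
                      (_ , i≡k′ , f) = dia-elim {m} (at i) φ atφ
                  in ¬f (⊨-subst M φ (trans (≡-sym i≡k′) i≡k) f))

  ⊨-at-intro : ∀ i φ → M , m ⊨ (nom i ⇒ (φ ⇔ atF e₀ i φ))
  ⊨-at-intro i φ = ⇒-intro λ i≡m → ⇔-intro
    (dia-intro {m} (at i) φ i≡m)
    (λ atφ → let (_ , i≡k , f) = dia-elim {m} (at i) φ atφ
            in ⊨-subst M φ (trans (≡-sym i≡k) i≡m) f)

  ⊨-at-self : ∀ i → M , m ⊨ atF e₀ i (nom i)
  ⊨-at-self i = dia-intro {m} (at i) (nom i) refl refl

  ⊨-at-at : ∀ s i j α β →
    M , m ⊨ (cmp s (comp (at j) (comp (at i) α)) β ⇔ cmp s (comp (at i) α) β)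
  ⊨-at-at s i j α β = ⇔-intro
    (cmp-mapˡ s _ _ β λ { (_ , _ , a) → a })
    (cmp-mapˡ s _ _ β λ a → nomI M j , refl , a)

  ⊨-pre-at : ∀ s γ i α β → M , m ⊨ (cmp s (comp γ (comp (at i) α)) β ⇒ cmp s (comp (at i) α) β)
  ⊨-pre-at s γ i α β = ⇒-intro (cmp-mapˡ s _ _ β λ { (_ , _ , a) → a })

  ⊨-assoc : ∀ s α β γ η →
    M , m ⊨ (cmp s (comp (comp α β) γ) η ⇔ cmp s (comp α (comp β γ)) η)
  ⊨-assoc s α β γ η = ⇔-intro
    (cmp-mapˡ s _ _ η λ { (l , (l′ , a , b) , c) → l′ , a , l , b , c })
    (cmp-mapˡ s _ _ η λ { (l′ , a , l , b , c) → l , (l′ , a , b) , c })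

  ⊨-eps-mid : ∀ s α β γ → M , m ⊨ (cmp s (comp α β) γ ⇔ cmp s (comp α (comp eps β)) γ)
  ⊨-eps-mid s α β γ = ⇔-intro
    (cmp-mapˡ s _ _ γ λ { (l , a , b) → l , a , l , (refl , ⊨Top) , b })
    (cmp-mapˡ s _ _ γ λ { (l , a , _ , (refl , _) , b) → l , a , b })

  ⊨-eps-left : ∀ s β γ → M , m ⊨ (cmp s β γ ⇔ cmp s (comp eps β) γ)
  ⊨-eps-left s β γ = ⇔-intro
    (cmp-mapˡ s _ _ γ λ b → m , (refl , ⊨Top) , b)
    (cmp-mapˡ s _ _ γ λ { (_ , (refl , _) , b) → b })

  ⊨-eps-right : ∀ s α γ → M , m ⊨ (cmp s α γ ⇔ cmp s (comp α eps) γ)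
  ⊨-eps-right s α γ = ⇔-intro
    (cmp-mapˡ s _ _ γ λ {n} a → n , a , refl , ⊨Top)
    (cmp-mapˡ s _ _ γ λ { (_ , a , refl , _) → a })

  ⊨-dia-comp : ∀ α β φ → M , m ⊨ (dia e₀ (comp α β) φ ⇔ dia e₀ α (dia e₀ β φ))
  ⊨-dia-comp α β φ = ⇔-intro
    (λ d → let (k , (l , a , b) , f) = dia-elim {m} (comp α β) φ d
           in dia-intro α (dia e₀ β φ) a (dia-intro β φ b f))
    (λ d → let (l , a , d′) = dia-elim {m} α (dia e₀ β φ) d
               (k , b , f) = dia-elim β φ d′
           in dia-intro (comp α β) φ (l , a , b) f)

  ⊨-eps-eq : ∀ e → M , m ⊨ eqP e eps eps
  ⊨-eps-eq e = m , m , (refl , ⊨Top) , (refl , ⊨Top) , ∼.refl e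

  ⊨-eps-neq : ∀ e → M , m ⊨ neg (neqP e eps eps)
  ⊨-eps-neq e (_ , _ , (refl , _) , (refl , _) , m≁m) = m≁m (∼.refl e)

  ⊨-nom-neq : ∀ e i j → M , m ⊨ (neg (eqP e (at i) (at j)) ⇔ neqP e (at i) (at j))
  ⊨-nom-neq e i j = ⇔-intro
    (λ ¬eq → nomI M i , nomI M j , refl , refl ,
               λ i∼j → ¬eq (nomI M i , nomI M j , refl , refl , i∼j))
    (λ { (_ , _ , refl , refl , i≁j) (_ , _ , refl , refl , i∼j) → i≁j i∼j })

  ⊨-eq-trans : ∀ e α β → M , m ⊨ (and (eqP e eps α) (eqP e eps β) ⇒ eqP e α β)
  ⊨-eq-trans e α β = ⇒-intro
    λ { ((_ , n , (refl , _) , a , m∼n) , (_ , l , (refl , _) , b , m∼l))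
        → n , l , a , b , ∼.trans e (∼.sym e m∼n) m∼l }

  ⊨-sym : ∀ s α β → M , m ⊨ (cmp s α β ⇔ cmp s β α)
  ⊨-sym s α β = ⇔-intro (swap α β) (swap β α)
    where
    swap : ∀ α β → M , m ⊨ cmp s α β → M , m ⊨ cmp s β α
    swap α β c with cmp-elim s α β c
    ... | n , l , a , b , x = cmp-intro s β α (l , n , b , a , Sim⋆-sym s x)

  ⊨-test-head : ∀ s φ α β → M , m ⊨ (cmp s (comp (test φ) α) β ⇔ and φ (cmp s α β))
  ⊨-test-head s φ α β = ⇔-intro
    (λ c → split (cmp-elim s _ β c))
    (λ { (f , c) → cmp-mapˡ s α _ β (λ a → m , (refl , f) , a) c })
    where
    split : Compared s m (comp (test φ) α) β → M , m ⊨ and φ (cmp s α β)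
    split (n , l , (_ , (refl , f) , a) , b , x) = f , cmp-intro s α β (n , l , a , b , x)

  ⊨-at-both : ∀ s i α β →
    M , m ⊨ (cmp s (comp (at i) α) (comp (at i) β) ⇒ atF e₀ i (cmp s α β))
  ⊨-at-both s i α β = ⇒-intro λ c → go (cmp-elim s _ _ c)
    where
    go : Compared s m (comp (at i) α) (comp (at i) β) → M , m ⊨ atF e₀ i (cmp s α β)
    go (n , l , (_ , refl , a) , (_ , refl , b) , x) =
      dia-intro {m} (at i) (cmp s α β) refl (cmp-intro s α β (n , l , a , b , x))

  ⊨-prefix : ∀ s α β γ → M , m ⊨ (cmp s (comp α β) γ ⇒ dia e₀ α Top)
  ⊨-prefix s α β γ = ⇒-intro λ c → go (cmp-elim s _ γ c)
    where
    go : Compared s m (comp α β) γ → M , m ⊨ dia e₀ α Top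
    go (_ , _ , (_ , a , _) , _) = dia-intro α Top a ⊨Top

  ⊨-dia-cmp : ∀ s α β γ → M , m ⊨ (dia e₀ α (cmp s β γ) ⇒ cmp s (comp α β) (comp α γ))
  ⊨-dia-cmp s α β γ = ⇒-intro λ d →
    let (k , a , c) = dia-elim {m} α (cmp s β γ) d
        (n , l , b , g , x) = cmp-elim s β γ c
    in cmp-intro s _ _ (n , l , (k , a , b) , (k , a , g) , x)

module FirstOrder {Mod Eq : Set} (F : Frame Mod Eq) where
  private
    U : Set
    U = Frame.W F

  ⟦_⟧ : FO Mod Eq → (Var → U) → Set
  ⟦_⟧ = ⟦_⟧FO F

  _[_↦_] : (Var → U) → Var → U → (Var → U)
  _[_↦_] = update F

  update-same : ∀ g v d → (g [ v ↦ d ]) v ≡ d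
  update-same g v d with v ≟V v
  ... | yes _ = refl
  ... | no v≢v = ⊥-elim (v≢v refl)

  update-other : ∀ g v d {u} → u ≢ v → (g [ v ↦ d ]) u ≡ g u
  update-other g v d {u} u≢v with u ≟V v
  ... | yes u≡v = ⊥-elim (u≢v u≡v)
  ... | no _ = refl

  update-id : ∀ g v u → (g [ v ↦ g v ]) u ≡ g u
  update-id g v u with u ≟V v
  ... | yes refl = refl
  ... | no _ = refl

  update-cong : ∀ {g h} v d → (∀ u → g u ≡ h u) → ∀ u → (g [ v ↦ d ]) u ≡ (h [ v ↦ d ]) u
  update-cong v d g≗h u with u ≟V v
  ... | yes _ = refl
  ... | no _ = g≗h u

  ⟦⟧-cong : ∀ χ {g h} → (∀ u → g u ≡ h u) → ⟦ χ ⟧ g → ⟦ χ ⟧ h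
  ⟦⟧-cong (eqv u v)   g≗h s = trans (≡-sym (g≗h u)) (trans s (g≗h v))
  ⟦⟧-cong (Rel a u v) g≗h s = subst₂ (Frame.R F a) (g≗h u) (g≗h v) s
  ⟦⟧-cong (D e u v)   g≗h s = subst₂ (Frame.Sim F e) (g≗h u) (g≗h v) s
  ⟦⟧-cong (fneg χ)    g≗h ¬s t = ¬s (⟦⟧-cong χ (λ u → ≡-sym (g≗h u)) t)
  ⟦⟧-cong (fand χ ξ)  g≗h (s , t) = ⟦⟧-cong χ g≗h s , ⟦⟧-cong ξ g≗h t
  ⟦⟧-cong (fex v χ)   g≗h (d , s) = d , ⟦⟧-cong χ (update-cong v d g≗h) s
  ⟦⟧-cong (fall v χ)  g≗h s d = ⟦⟧-cong χ (update-cong v d g≗h) (s d)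

  fall-elim : ∀ v χ g → ⟦ fall v χ ⟧ g → ⟦ χ ⟧ g
  fall-elim v χ g s = ⟦⟧-cong χ (update-id g v) (s (g v))

  allNoms-elim : ∀ ns χ g → ⟦ allNoms ns χ ⟧ g → ⟦ χ ⟧ g
  allNoms-elim []       χ g s = s
  allNoms-elim (i ∷ ns) χ g s = allNoms-elim ns χ g (fall-elim (inj₂ i) (allNoms ns χ) g s)

  closure-elim : ∀ ns χ → FrameSat F (fall xVar (allNoms ns χ)) → ∀ g → ⟦ χ ⟧ g
  closure-elim ns χ holds g = allNoms-elim ns χ g (fall-elim xVar (allNoms ns χ) g (holds g))

  exNoms-elim : ∀ js χ g → ⟦ exNoms js χ ⟧ g →
    Σ (Var → U) λ h → ⟦ χ ⟧ h
      × (∀ i → i ∉ js → h (inj₂ i) ≡ g (inj₂ i))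
      × (∀ k → h (inj₁ k) ≡ g (inj₁ k))
  exNoms-elim []       χ g s       = g , s , (λ _ _ → refl) , (λ _ → refl)
  exNoms-elim (j ∷ js) χ g (d , s) with exNoms-elim js χ (g [ inj₂ j ↦ d ]) s
  ... | h , sh , same-nom , same-aux = h , sh ,
    (λ i i∉ → trans (same-nom i (λ i∈ → i∉ (there i∈)))
                    (update-other g (inj₂ j) d λ { refl → i∉ (here refl) })) ,
    (λ k → trans (same-aux k) (update-other g (inj₂ j) d λ ()))

module Translation {Mod Eq : Set} (M : Model Mod Eq) where
  open FirstOrder (frame M)

  Below : ℕ → Var → Set
  Below k (inj₁ j) = j < k
  Below k (inj₂ _) = ⊤

  below-suc : ∀ {k} x → Below k x → Below (suc k) x
  below-suc (inj₁ _) j<k = m<n⇒m<1+n j<k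
  below-suc (inj₂ _) _   = _

  below⇒≢ : ∀ {k} x → Below k x → x ≢ inj₁ k
  below⇒≢ (inj₁ _) k<k refl = <-irrefl refl k<k

  InterpretsNominals : (Var → W M) → Set
  InterpretsNominals g = ∀ i → g (inj₂ i) ≡ nomI M i

  interpretsNominals-update : ∀ g k d → InterpretsNominals g → InterpretsNominals (g [ inj₁ k ↦ d ])
  interpretsNominals-update g k d G i = trans (update-other g (inj₁ k) d λ ()) (G i)

  nominalVar-correct : ∀ g → InterpretsNominals g → ∀ u i → (g u ≡ g (inj₂ i)) ⟺ (nomI M i ≡ g u)
  nominalVar-correct g G u i = mk⇔ (λ e → ≡-sym (trans e (G i))) (λ e → ≡-sym (trans (G i) e))

  mutual
    STP-correct : ∀ α → PureP α → ∀ k x y g → InterpretsNominals g → Below k x → Below k y →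
      ⟦ STP x y k α ⟧ g ⟺ (M , g x , g y ⊨P α)
    STP-correct (mod a)  _  k x y g G _ _ = ⟺.refl
    STP-correct (at i)   _  k x y g G _ _ = nominalVar-correct g G y i
    STP-correct (test φ) pφ k x y g G _ by = mk⇔
      (λ (x≡y , s) → x≡y , ⊨-subst M φ (≡-sym x≡y) (to IH s))
      (λ (x≡y , f) → x≡y , from IH (⊨-subst M φ x≡y f))
      where
      IH : ⟦ STF y k φ ⟧ g ⟺ (M , g y ⊨ φ)
      IH = STF-correct φ pφ k y g G by
    STP-correct (comp α β) (pα , pβ) k x y g G bx by = mk⇔
      (λ (d , a , b) → d , to (IHα d) a , to (IHβ d) b)
      (λ (d , a , b) → d , from (IHα d) a , from (IHβ d) b)
      where
      module _ (d : W M) where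
        g′ : Var → W M
        g′ = g [ inj₁ k ↦ d ]
        IHα : ⟦ STP x (inj₁ k) (suc k) α ⟧ g′ ⟺ (M , g x , d ⊨P α)
        IHα = ⟺.trans
          (STP-correct α pα (suc k) x (inj₁ k) g′ (interpretsNominals-update g k d G)
            (below-suc x bx) (n<1+n k))
          (subst₂-⟺ (λ a b → M , a , b ⊨P α)
            (update-other g (inj₁ k) d (below⇒≢ x bx)) (update-same g (inj₁ k) d))
        IHβ : ⟦ STP (inj₁ k) y (suc k) β ⟧ g′ ⟺ (M , d , g y ⊨P β)
        IHβ = ⟺.trans
          (STP-correct β pβ (suc k) (inj₁ k) y g′ (interpretsNominals-update g k d G)
            (n<1+n k) (below-suc y by))
          (subst₂-⟺ (λ a b → M , a , b ⊨P β)
            (update-same g (inj₁ k) d) (update-other g (inj₁ k) d (below⇒≢ y by)))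

    STF-correct : ∀ φ → Pure φ → ∀ k x g → InterpretsNominals g → Below k x →
      ⟦ STF x k φ ⟧ g ⟺ (M , g x ⊨ φ)
    STF-correct (prop _) ()
    STF-correct (nom i)   _  k x g G _  = nominalVar-correct g G x i
    STF-correct (neg φ)   pφ k x g G bx = mk⇔ (λ ¬s f → ¬s (from IH f)) (λ ¬f s → ¬f (to IH s))
      where
      IH : ⟦ STF x k φ ⟧ g ⟺ (M , g x ⊨ φ)
      IH = STF-correct φ pφ k x g G bx
    STF-correct (and φ ψ) (pφ , pψ) k x g G bx = mk⇔
      (λ (s , t) → to IHφ s , to IHψ t)
      (λ (s , t) → from IHφ s , from IHψ t)
      where
      IHφ : ⟦ STF x k φ ⟧ g ⟺ (M , g x ⊨ φ)
      IHφ = STF-correct φ pφ k x g G bx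
      IHψ : ⟦ STF x k ψ ⟧ g ⟺ (M , g x ⊨ ψ)
      IHψ = STF-correct ψ pψ k x g G bx
    STF-correct (eqP e α β)  (pα , pβ) k x g G bx =
      STF-compare-correct α β pα pβ k x g G bx (Sim M e) (D e (inj₁ k) (inj₁ (suc k))) λ _ → ⟺.refl
    STF-correct (neqP e α β) (pα , pβ) k x g G bx =
      STF-compare-correct α β pα pβ k x g G bx
        (λ n l → ¬ Sim M e n l) (fneg (D e (inj₁ k) (inj₁ (suc k))))
        λ _ → ⟺.refl

    STF-compare-correct : ∀ α β → PureP α → PureP β → ∀ k x g → InterpretsNominals g → Below k x →
      (S : W M → W M → Set) (χ : FO Mod Eq) →
      (∀ h → ⟦ χ ⟧ h ⟺ S (h (inj₁ k)) (h (inj₁ (suc k)))) →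
      ⟦ fex (inj₁ k) (fex (inj₁ (suc k))
          (fand (fand (STP x (inj₁ k) (2 + k) α) (STP x (inj₁ (suc k)) (2 + k) β)) χ)) ⟧ g
      ⟺ (Σ (W M) λ n → Σ (W M) λ l → (M , g x , n ⊨P α) × (M , g x , l ⊨P β) × S n l)
    STF-compare-correct α β pα pβ k x g G bx S χ χ-correct = mk⇔
      (λ (n , l , (a , b) , s) → n , l , to (IHα n l) a , to (IHβ n l) b , to (IHχ n l) s)
      (λ (n , l , a , b , s) → n , l , (from (IHα n l) a , from (IHβ n l) b) , from (IHχ n l) s)
      where
      module _ (n l : W M) where
        g′ : Var → W M
        g′ = (g [ inj₁ k ↦ n ]) [ inj₁ (suc k) ↦ l ]
        G′ : InterpretsNominals g′
        G′ = interpretsNominals-update (g [ inj₁ k ↦ n ]) (suc k) l (interpretsNominals-update g k n G)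
        bx′ : Below (2 + k) x
        bx′ = below-suc x (below-suc x bx)
        x-kept : g′ x ≡ g x
        x-kept = trans (update-other _ (inj₁ (suc k)) l (below⇒≢ x (below-suc x bx)))
                       (update-other g (inj₁ k) n (below⇒≢ x bx))
        n-kept : g′ (inj₁ k) ≡ n
        n-kept = trans (update-other _ (inj₁ (suc k)) l (below⇒≢ (inj₁ k) (n<1+n k)))
                       (update-same g (inj₁ k) n)
        l-set : g′ (inj₁ (suc k)) ≡ l
        l-set = update-same _ (inj₁ (suc k)) l
        IHα : ⟦ STP x (inj₁ k) (2 + k) α ⟧ g′ ⟺ (M , g x , n ⊨P α)
        IHα = ⟺.trans (STP-correct α pα (2 + k) x (inj₁ k) g′ G′ bx′ (m<n⇒m<1+n (n<1+n k)))
                      (subst₂-⟺ (λ a b → M , a , b ⊨P α) x-kept n-kept)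
        IHβ : ⟦ STP x (inj₁ (suc k)) (2 + k) β ⟧ g′ ⟺ (M , g x , l ⊨P β)
        IHβ = ⟺.trans (STP-correct β pβ (2 + k) x (inj₁ (suc k)) g′ G′ bx′ (n<1+n (suc k)))
                      (subst₂-⟺ (λ a b → M , a , b ⊨P β) x-kept l-set)
        IHχ : ⟦ χ ⟧ g′ ⟺ S n l
        IHχ = ⟺.trans (χ-correct g′) (subst₂-⟺ S n-kept l-set)

  ST-sound : ∀ φ → Pure φ → ∀ g → InterpretsNominals g → ⟦ ST φ ⟧ g → M , g xVar ⊨ φ
  ST-sound φ pφ g G = to (STF-correct φ pφ 1 xVar g G (n<1+n 0))

withNom : ∀ {Mod Eq} (M : Model Mod Eq) → (NomSym → W M) → Model Mod Eq
withNom M f = record { frame = frame M ; V = V M ; nomI = f }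

reassign : {A : Set} → (NomSym → A) → NomSym → A → NomSym → A
reassign f j d i with i ≟ℕ j
... | yes _ = d
... | no  _ = f i

reassign-same : ∀ {A : Set} (f : NomSym → A) j d → reassign f j d j ≡ d
reassign-same f j d with j ≟ℕ j
... | yes _   = refl
... | no  j≢j = ⊥-elim (j≢j refl)

reassign-other : ∀ {A : Set} (f : NomSym → A) j d {i} → i ≢ j → reassign f j d i ≡ f i
reassign-other f j d {i} i≢j with i ≟ℕ j
... | yes i≡j = ⊥-elim (i≢j i≡j)
... | no  _   = refl

module Reassignment {Mod Eq : Set} (M : Model Mod Eq) where
  Agree : (NomSym → W M) → (NomSym → W M) → List NomSym → Set
  Agree f f′ = All (λ i → f i ≡ f′ i)

  Agree-sym : ∀ {f f′ ns} → Agree f f′ ns → Agree f′ f ns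
  Agree-sym = All.map ≡-sym

  reassign-agree : ∀ f j d {ns} → j ∉ ns → Agree f (reassign f j d) ns
  reassign-agree f j d j∉ns = All.tabulate λ i∈ns →
    ≡-sym (reassign-other f j d λ { refl → j∉ns i∈ns })

  mutual
    ⊨P-agree : ∀ α {f f′} → Agree f f′ (nomsP α) →
      ∀ {m n} → withNom M f , m , n ⊨P α → withNom M f′ , m , n ⊨P α
    ⊨P-agree (mod a)    ag r = r
    ⊨P-agree (at i)     ag i≡n = trans (≡-sym (All.head ag)) i≡n
    ⊨P-agree (test φ)   ag (m≡n , f) = m≡n , ⊨-agree φ ag f
    ⊨P-agree (comp α β) ag (l , a , b) =
      l , ⊨P-agree α (++⁻ˡ (nomsP α) ag) a , ⊨P-agree β (++⁻ʳ (nomsP α) ag) b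

    ⊨-agree : ∀ φ {f f′} → Agree f f′ (nomsF φ) →
      ∀ {m} → withNom M f , m ⊨ φ → withNom M f′ , m ⊨ φ
    ⊨-agree (prop p)     ag v = v
    ⊨-agree (nom i)      ag i≡m = trans (≡-sym (All.head ag)) i≡m
    ⊨-agree (neg φ)      ag ¬f f = ¬f (⊨-agree φ (Agree-sym ag) f)
    ⊨-agree (and φ ψ)    ag (f , g) =
      ⊨-agree φ (++⁻ˡ (nomsF φ) ag) f , ⊨-agree ψ (++⁻ʳ (nomsF φ) ag) g
    ⊨-agree (eqP e α β)  ag (n , l , a , b , x) =
      n , l , ⊨P-agree α (++⁻ˡ (nomsP α) ag) a , ⊨P-agree β (++⁻ʳ (nomsP α) ag) b , x
    ⊨-agree (neqP e α β) ag (n , l , a , b , x) =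
      n , l , ⊨P-agree α (++⁻ˡ (nomsP α) ag) a , ⊨P-agree β (++⁻ʳ (nomsP α) ag) b , x

module FrameConditions {Mod Eq : Set} (M : Model Mod Eq) where
  open FirstOrder (frame M)

  valuationAt : W M → Var → W M
  valuationAt m (inj₁ _) = m
  valuationAt m (inj₂ i) = nomI M i

  FCax-valid : ∀ φ → Pure φ → FrameSat (frame M) (FCax φ) → ∀ m → M , m ⊨ φ
  FCax-valid φ pφ holds m = Translation.ST-sound M φ pφ (valuationAt m) (λ _ → refl)
    (closure-elim (nomsF φ) (ST φ) holds (valuationAt m))

  FCrule-witness : ∀ r → Pure (headF r) → FrameSat (frame M) (FCrule r) → ∀ m →
    Σ (NomSym → W M) λ f → (withNom M f , m ⊨ headF r) × (∀ i → i ∉ exN r → f i ≡ nomI M i)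
  FCrule-witness r pr holds m
    with exNoms-elim (exN r) (ST (headF r)) (valuationAt m)
           (closure-elim (univN r) (exNoms (exN r) (ST (headF r))) holds (valuationAt m))
  ... | h , sh , same-nom , same-aux =
    f , ⊨-subst M′ (headF r) (same-aux 0) (Translation.ST-sound M′ (headF r) pr h (λ _ → refl) sh) ,
    same-nom
    where
    f : NomSym → W M
    f i = h (inj₂ i)
    M′ : Model Mod Eq
    M′ = withNom M f

module Soundness (em : ExcludedMiddle 0ℓ) {Mod Eq : Set} (e₀ : Eq)
  (Π : Form Mod Eq → Set) (P : ESR Mod Eq → Set) where

  axiom-sound : ((φ : Form Mod Eq) → Π φ → Pure φ) →
    (M : Model Mod Eq) → InC Π P M → (φ : Form Mod Eq) → Ax e₀ Π φ → (m : W M) → M , m ⊨ φ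
  axiom-sound pureΠ M (satΠ , _) _ ax m = go ax
    where
    open Axioms e₀ M m
    go : ∀ {φ} → Ax e₀ Π φ → M , m ⊨ φ
    go (taut τ σ t)          = Satisfaction.⊨-taut e₀ M em m σ τ t
    go (K α φ ψ)             = ⊨-K α φ ψ
    go (at-neg i φ)          = ⊨-at-neg i φ
    go (at-intro i φ)        = ⊨-at-intro i φ
    go (at-self i)           = ⊨-at-self i
    go (at-at s i j α β)     = ⊨-at-at s i j α β
    go (pre-at s γ i α β)    = ⊨-pre-at s γ i α β
    go (assoc s α β γ η)     = ⊨-assoc s α β γ η
    go (eps-mid s α β γ)     = ⊨-eps-mid s α β γ
    go (eps-left s β γ)      = ⊨-eps-left s β γ
    go (eps-right s α γ)     = ⊨-eps-right s α γ
    go (dia-comp α β φ)      = ⊨-dia-comp α β φ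
    go (eps-eq e)            = ⊨-eps-eq e
    go (eps-neq e)           = ⊨-eps-neq e
    go (nom-neq e i j)       = ⊨-nom-neq e i j
    go (eq-trans e α β)      = ⊨-eq-trans e α β
    go (sym s α β)           = ⊨-sym s α β
    go (test-head s φ α β)   = ⊨-test-head s φ α β
    go (at-both s i α β)     = ⊨-at-both s i α β
    go (prefix s α β γ)      = ⊨-prefix s α β γ
    go (dia-cmp s α β γ)     = ⊨-dia-cmp s α β γ
    go (pi φ πφ)             = FrameConditions.FCax-valid M φ (pureΠ φ πφ) (satΠ φ πφ) m

  name-sound : ∀ j φ → j ∉ nomsF φ → ValidC Π P (atF e₀ j φ) → ValidC Π P φ
  name-sound j φ j∉φ valid M c m =
    ⊨-agree φ (Agree-sym (reassign-agree (nomI M) j m j∉φ))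
      (⊨-subst M′ φ (reassign-same (nomI M) j m) (Satisfaction.atF-elim e₀ M′ {m} j φ (valid M′ c m)))
    where
    open Reassignment M
    M′ : Model Mod Eq
    M′ = withNom M (reassign (nomI M) j m)

  paste-sound : ∀ s i j a α β θ → j ≢ i → j ∉ nomsP α → j ∉ nomsP β → j ∉ nomsF θ →
    ValidC Π P (and (atF e₀ i (dia e₀ (mod a) (nom j))) (cmp s (comp (at j) α) β) ⇒ θ) →
    ValidC Π P (cmp s (comp (at i) (comp (mod a) α)) β ⇒ θ)
  paste-sound s i j a α β θ j≢i j∉α j∉β j∉θ valid M c m =
    ⇒-intro λ path → go (Satisfaction.cmp-elim e₀ M s _ β path)
    where
    open Reassignment M
    go : Satisfaction.Compared e₀ M s m (comp (at i) (comp (mod a) α)) β → M , m ⊨ θ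
    go (n , l , (k , i≡k , k′ , kRk′ , αk′n) , βml , x) =
      ⊨-agree θ (Agree-sym (reassign-agree (nomI M) j k′ j∉θ))
        (⇒-elim em (valid M′ c m) (at-i-aj , j-path))
      where
      M′ : Model Mod Eq
      M′ = withNom M (reassign (nomI M) j k′)
      open Satisfaction e₀ M′
      j↦k′ : reassign (nomI M) j k′ j ≡ k′
      j↦k′ = reassign-same (nomI M) j k′
      at-i-aj : M′ , m ⊨ atF e₀ i (dia e₀ (mod a) (nom j))
      at-i-aj = dia-intro {m} (at i) (dia e₀ (mod a) (nom j))
        (trans (reassign-other (nomI M) j k′ λ i≡j → j≢i (≡-sym i≡j)) i≡k)
        (dia-intro {k} (mod a) (nom j) kRk′ j↦k′)
      j-path : M′ , m ⊨ cmp s (comp (at j) α) β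
      j-path = cmp-intro s (comp (at j) α) β
        (n , l , (k′ , j↦k′ , ⊨P-agree α (reassign-agree (nomI M) j k′ j∉α) αk′n) ,
         ⊨P-agree β (reassign-agree (nomI M) j k′ j∉β) βml , x)

  sat-sound : ((r : ESR Mod Eq) → P r → Pure (headF r)) →
    ∀ r ψ → P r → All (_∉ nomsF ψ) (exN r) → ValidC Π P (headF r ⇒ ψ) → ValidC Π P ψ
  sat-sound pureP r ψ Pr fresh valid M c@(_ , satP) m
    with FrameConditions.FCrule-witness M r (pureP r Pr) (satP r Pr) m
  ... | f , head , f≡nomI =
    ⊨-agree ψ (All.tabulate λ i∈ψ → f≡nomI _ λ i∈exN → All.lookup fresh i∈exN i∈ψ)
      (⇒-elim em (valid (withNom M f) c m) head)
    where open Reassignment M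

  rule-sound : ((r : ESR Mod Eq) → P r → Pure (headF r)) →
    (prems : List (Form Mod Eq)) (c : Form Mod Eq) → Rule e₀ Π P prems c →
    All (ValidC Π P) prems → ValidC Π P c
  rule-sound _ _ _ (mp φ ψ) (vφ All.∷ vφ⇒ψ All.∷ All.[]) M c m =
    ⇒-elim em (vφ⇒ψ M c m) (vφ M c m)
  rule-sound _ _ _ (nec α φ) (vφ All.∷ All.[]) M c m =
    Satisfaction.box-intro e₀ M α φ λ _ ¬φ → ¬φ (vφ M c _)
  rule-sound _ _ _ (name j φ j∉φ) (v All.∷ All.[]) = name-sound j φ j∉φ v
  rule-sound _ _ _ (paste s i j a α β θ j≢i j∉α j∉β j∉θ) (v All.∷ All.[]) =
    paste-sound s i j a α β θ j≢i j∉α j∉β j∉θ v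
  rule-sound pureP _ _ (sat r ψ Pr fresh) (v All.∷ All.[]) = sat-sound pureP r ψ Pr fresh v

theorem3p8 : ExcludedMiddle 0ℓ →
    (Mod Eq : Set) (e₀ : Eq)
    (Π : Form Mod Eq → Set) (P : ESR Mod Eq → Set) →
    ((φ : Form Mod Eq) → Π φ → Pure φ) →
    ((r : ESR Mod Eq) → P r → Pure (headF r)) →
    ((M : Model Mod Eq) → InC Π P M →
       (φ : Form Mod Eq) → Ax e₀ Π φ → (m : W M) → M , m ⊨ φ)
    × ((prems : List (Form Mod Eq)) (c : Form Mod Eq) → Rule e₀ Π P prems c →
       All (ValidC Π P) prems → ValidC Π P c)
theorem3p8 em Mod Eq e₀ Π P pureΠ pureP = axiom-sound pureΠ , rule-sound pureP
  where open Soundness em e₀ Π P
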